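{- Every simplicial complex $\Delta$ with $m$ facets is $(m+1)$-colorfully representable.
   Context: A simplicial complex on vertex set $[n]$ is a downward-closed family $\Delta\subseteq2^{[n]}$; its facets are its inclusion-maximal faces. A subword is obtained by deleting some letter occurrences. For $\sigma$ with $|\sigma|=r\ge2$, a $d$-colorful word on $\sigma$ is a word of length $(d+1)(r-1)+1$ such that for every $i\in[d+1]$ the segment at positions $(i-1)(r-1)+1$ through $i(r-1)+1$ inclusive contains every letter of $\sigma$ exactly once. $\Delta$ is $d$-colorfully representable if there is a word $W$ on $[n]$ such that for every $\sigma\subseteq[n]$ (with $|\sigma|\ge2$), $\sigma\in\Delta$ iff $W$ contains a $d$-colorful subword on alphabet $\sigma$. -}

module Defs where

open import Level using (0ℓ)
open import Data.Nat using (ℕ; suc; _+_; _*_; _∸_; _≤_; _<_)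
open import Data.Fin using (Fin; _≟_)
open import Data.Fin.Subset using (Subset; _⊆_; _∈_; ∣_∣)
open import Data.List using (List; length; take; drop; filter)
open import Data.List.Relation.Unary.All using (All)
open import Data.List.Relation.Unary.Unique.Propositional using (Unique)
import Data.List.Membership.Propositional as LM
import Data.List.Relation.Binary.Sublist.Propositional as SL
open import Data.Product using (Σ; _×_)
open import Relation.Binary.PropositionalEquality using (_≡_)
open import Relation.Unary using (Decidable)

-- A simplicial complex on vertex set [n] (here Fin n): a downward-closed
-- family of subsets of [n].  Membership is decidable (automatic classically,
-- since the family is a finite object).
record SimplicialComplex (n : ℕ) : Set₁ where
  field
    face      : Subset n → Set
    face?     : Decidable face
    downClose : ∀ {σ τ} → τ ⊆ σ → face σ → face τ
open SimplicialComplex public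

IsFacet : ∀ {n} → SimplicialComplex n → Subset n → Set
IsFacet Δ σ = face Δ σ × (∀ τ → face Δ τ → σ ⊆ τ → τ ≡ σ)

HasFacetCount : ∀ {n} → SimplicialComplex n → ℕ → Set
HasFacetCount {n} Δ m =
  Σ (List (Subset n)) λ fs →
    Unique fs × length fs ≡ m ×
    (∀ σ → (σ LM.∈ fs → IsFacet Δ σ) × (IsFacet Δ σ → σ LM.∈ fs))

occ : ∀ {n} → Fin n → List (Fin n) → ℕ
occ x w = length (filter (x ≟_) w)

-- u is a d-colorful word on σ (with r = |σ|, r ≥ 2 is assumed by the caller):
-- length (d+1)(r-1)+1, all letters in σ, and for each i ∈ {0,…,d} the
-- segment of (1-indexed) positions i(r-1)+1 … (i+1)(r-1)+1 contains every
-- letter of σ exactly once.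
IsColorful : ∀ {n} → ℕ → Subset n → List (Fin n) → Set
IsColorful {n} d σ u =
  length u ≡ suc d * (r ∸ 1) + 1 ×
  All (_∈ σ) u ×
  (∀ i → i ≤ d → ∀ (x : Fin n) → x ∈ σ → occ x (take r (drop (i * (r ∸ 1)) u)) ≡ 1)
  where r = ∣ σ ∣

ColorfullyRepresentable : ∀ {n} → ℕ → SimplicialComplex n → Set
ColorfullyRepresentable {n} d Δ =
  Σ (List (Fin n)) λ W →
    ∀ (σ : Subset n) → 2 ≤ ∣ σ ∣ →
      (face Δ σ → Σ (List (Fin n)) λ u → u SL.⊆ W × IsColorful d σ u)
      × ((Σ (List (Fin n)) λ u → u SL.⊆ W × IsColorful d σ u) → face Δ σ)

-- Fix facets F₁ … F_m and d = m + 1, and let W concatenate, over the facets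
-- F, the words (elements of F)^(d+2).  If σ is a face, it lies in some facet
-- τ, and the prefix of length (d+1)(r-1)+1 of (elements of σ)^(d+2) is a
-- subword of W: its segments are windows of length r = |σ| in a word of
-- period r, hence rotations of the elements of σ, so it is d-colorful.
-- Conversely, consecutive segments of a colorful subword overlap in a single
-- letter, so a segment that does not lie inside the current block of W uses
-- up that block; since there are d+1 > m segments, some segment, and with it
-- all of σ, lies inside one block, hence inside a facet, and σ is a face.
{-# OPTIONS --safe #-}
module Submission where

open import Defs
open import Data.Nat using (ℕ; zero; suc; _+_; _*_; _∸_; _≤_; _⊓_; z≤n; s≤s; _≤?_)
open import Data.Nat.Properties
  using (module ≤-Reasoning; +-suc; +-comm; ≤-trans; m≤n⇒m⊓n≡m; +-mono-≤; +-monoˡ-≤; *-mono-≤; *-monoˡ-≤; *-monoʳ-≤;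
         m∸n≤m; m≤m+n; <⇒≤; m∸n+n≡m; m+n∸m≡n; n≤1+n; m+[n∸m]≡n; ∸-monoˡ-≤; ≰⇒>)
open import Data.Fin using (Fin; zero; suc; _≟_)
open import Data.Fin.Subset using (Subset; inside; outside; _⊆_; _⊂_; _⊃_; _∈_; _∉_; ∣_∣; _∪_; ⁅_⁆; Nonempty)
open import Data.Fin.Subset.Properties
  using (_∈?_; nonempty?; Empty-unique; ∣⊥∣≡0; drop-∷-⊆; ⊆-antisym; p⊆p∪q;
         x∈p∪q⁻; x∈p∪q⁺; x∈⁅x⁆; x∈⁅y⁆⇒x≡y)
open import Data.Fin.Subset.Induction using (Acc; acc; ⊃-wellFounded)
open import Data.Fin.Properties using (any?)
open import Data.Vec using ([]; _∷_; here; there)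
open import Data.List using (List; []; _∷_; _++_; length; take; drop; filter; map; concat; replicate)
open import Data.List.Properties using (length-++; length-map; length-drop; length-take; take-take; take-drop; take-[]; drop-drop; take++drop≡id; filter-++)
open import Data.List.Relation.Unary.All as All using (All; []; _∷_)
import Data.List.Relation.Unary.All.Properties as All
open import Data.List.Relation.Unary.Any using (Any; here; there)
import Data.List.Relation.Unary.Any.Properties as Any
import Data.List.Membership.Propositional as List
open import Data.List.Membership.Propositional.Properties using (∈-map⁺)
import Data.List.Relation.Binary.Sublist.Propositional as Sublist
open import Data.List.Relation.Binary.Sublist.Propositional using ([]; _∷_; _∷ʳ_; ⊆-refl; ⊆-trans)
open import Data.List.Relation.Binary.Sublist.Propositional.Properties
  using (++⁺; ++⁺ˡ; ++⁺ʳ; take-⊆; drop-⊆; map⁺; Any-resp-⊆)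
open import Data.Product using (Σ; ∃; _×_; _,_; proj₁; proj₂)
open import Data.Sum using (inj₁; inj₂)
open import Relation.Binary.PropositionalEquality using (_≡_; refl; sym; trans; cong; subst; module ≡-Reasoning)
open import Relation.Nullary using (¬_; yes; no; contradiction)
open import Relation.Nullary.Decidable using (¬?; _×-dec_)

module _ {A : Set} where

  repeat : ℕ → List A → List A
  repeat k xs = concat (replicate k xs)

  length-repeat : ∀ k (xs : List A) → length (repeat k xs) ≡ k * length xs
  length-repeat zero    xs = refl
  length-repeat (suc k) xs = trans (length-++ xs) (cong (length xs +_) (length-repeat k xs))

  repeat⁺ : ∀ k {xs ys : List A} → xs Sublist.⊆ ys → repeat k xs Sublist.⊆ repeat k ys
  repeat⁺ zero    _     = []
  repeat⁺ (suc k) xs⊆ys = ++⁺ xs⊆ys (repeat⁺ k xs⊆ys)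

  All-repeat : ∀ {P : A → Set} k {xs} → All P xs → All P (repeat k xs)
  All-repeat k pxs = All.concat⁺ (All.replicate⁺ k pxs)

  ∈⇒⊆-concat : ∀ {xs : List A} {xss} → xs List.∈ xss → xs Sublist.⊆ concat xss
  ∈⇒⊆-concat {xss = _ ∷ xss} (here refl) = ++⁺ʳ (concat xss) ⊆-refl
  ∈⇒⊆-concat {xss = ys ∷ _}  (there p)   = ++⁺ˡ ys (∈⇒⊆-concat p)

  ⊆-++-split : ∀ (xs : List A) {ys us} → us Sublist.⊆ xs ++ ys →
               ∃ λ us₁ → ∃ λ us₂ → us ≡ us₁ ++ us₂ × us₁ Sublist.⊆ xs × us₂ Sublist.⊆ ys
  ⊆-++-split []       p = [] , _ , refl , [] , p
  ⊆-++-split (x ∷ xs) (.x ∷ʳ p) with ⊆-++-split xs p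
  ... | us₁ , us₂ , refl , p₁ , p₂ = us₁ , us₂ , refl , x ∷ʳ p₁ , p₂
  ⊆-++-split (x ∷ xs) (refl ∷ p) with ⊆-++-split xs p
  ... | us₁ , us₂ , refl , p₁ , p₂ = x ∷ us₁ , us₂ , refl , refl ∷ p₁ , p₂

  take-++ˡ : ∀ k (xs ys : List A) → k ≤ length xs → take k (xs ++ ys) ≡ take k xs
  take-++ˡ zero    _        _  _       = refl
  take-++ˡ (suc k) (x ∷ xs) ys (s≤s k≤) = cong (x ∷_) (take-++ˡ k xs ys k≤)

  take-++ʳ : ∀ (xs ys : List A) k → take (length xs + k) (xs ++ ys) ≡ xs ++ take k ys
  take-++ʳ []       ys k = refl
  take-++ʳ (x ∷ xs) ys k = cong (x ∷_) (take-++ʳ xs ys k)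

  drop-++ˡ : ∀ k (xs ys : List A) → k ≤ length xs → drop k (xs ++ ys) ≡ drop k xs ++ ys
  drop-++ˡ zero    _        _  _       = refl
  drop-++ˡ (suc k) (x ∷ xs) ys (s≤s k≤) = drop-++ˡ k xs ys k≤

  drop-++ʳ : ∀ (xs ys : List A) k → drop (length xs + k) (xs ++ ys) ≡ drop k ys
  drop-++ʳ []       ys k = refl
  drop-++ʳ (x ∷ xs) ys k = drop-++ʳ xs ys k

  drop-++-≥ : ∀ k (xs ys : List A) → length xs ≤ k → drop k (xs ++ ys) ≡ drop (k ∸ length xs) ys
  drop-++-≥ k xs ys xs≤k = begin
    drop k (xs ++ ys)                            ≡⟨ cong (λ j → drop j (xs ++ ys)) (sym (m+[n∸m]≡n xs≤k)) ⟩
    drop (length xs + (k ∸ length xs)) (xs ++ ys) ≡⟨ drop-++ʳ xs ys (k ∸ length xs) ⟩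
    drop (k ∸ length xs) ys                      ∎
    where open ≡-Reasoning

  take-drop-take : ∀ j r N (xs : List A) → j + r ≤ N → take r (drop j (take N xs)) ≡ take r (drop j xs)
  take-drop-take j r N xs j+r≤N = begin
    take r (drop j (take N xs))           ≡⟨ take-drop r j (take N xs) ⟩
    drop j (take (j + r) (take N xs))     ≡⟨ cong (drop j) (take-take (j + r) N xs) ⟩
    drop j (take ((j + r) ⊓ N) xs)        ≡⟨ cong (λ k → drop j (take k xs)) (m≤n⇒m⊓n≡m j+r≤N) ⟩
    drop j (take (j + r) xs)              ≡⟨ take-drop r j xs ⟨
    take r (drop j xs)                    ∎
    where open ≡-Reasoning

  take-drop-rotate : ∀ j (xs ys : List A) → j ≤ length xs →
                     take (length xs) (drop j (xs ++ xs ++ ys)) ≡ drop j xs ++ take j xs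
  take-drop-rotate j xs ys j≤ = begin
    take (length xs) (drop j (xs ++ xs ++ ys))             ≡⟨ cong (take (length xs)) (drop-++ˡ j xs (xs ++ ys) j≤) ⟩
    take (length xs) (drop j xs ++ xs ++ ys)               ≡⟨ cong (λ k → take k (drop j xs ++ xs ++ ys)) length-xs ⟩
    take (length (drop j xs) + j) (drop j xs ++ xs ++ ys)  ≡⟨ take-++ʳ (drop j xs) (xs ++ ys) j ⟩
    drop j xs ++ take j (xs ++ ys)                         ≡⟨ cong (drop j xs ++_) (take-++ˡ j xs ys j≤) ⟩
    drop j xs ++ take j xs                                 ∎
    where
    open ≡-Reasoning
    length-xs : length xs ≡ length (drop j xs) + j
    length-xs = sym (trans (cong (_+ j) (length-drop j xs)) (m∸n+n≡m j≤))

module _ {n : ℕ} where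

  occ-++ : ∀ (x : Fin n) xs ys → occ x (xs ++ ys) ≡ occ x xs + occ x ys
  occ-++ x xs ys = trans (cong length (filter-++ (x ≟_) xs ys)) (length-++ (filter (x ≟_) xs))

  occ-rotate : ∀ (x : Fin n) j xs → occ x (drop j xs ++ take j xs) ≡ occ x xs
  occ-rotate x j xs = begin
    occ x (drop j xs ++ take j xs)        ≡⟨ occ-++ x (drop j xs) (take j xs) ⟩
    occ x (drop j xs) + occ x (take j xs) ≡⟨ +-comm (occ x (drop j xs)) (occ x (take j xs)) ⟩
    occ x (take j xs) + occ x (drop j xs) ≡⟨ occ-++ x (take j xs) (drop j xs) ⟨
    occ x (take j xs ++ drop j xs)        ≡⟨ cong (occ x) (take++drop≡id j xs) ⟩
    occ x xs                              ∎
    where open ≡-Reasoning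

  occ≡suc⇒∈ : ∀ {k} (x : Fin n) xs → occ x xs ≡ suc k → x List.∈ xs
  occ≡suc⇒∈ x (y ∷ xs) occ≡ with x ≟ y
  ... | yes x≡y = here x≡y
  ... | no  _   = there (occ≡suc⇒∈ x xs occ≡)

  occ-suc-map-suc : ∀ (x : Fin n) xs → occ (suc x) (map suc xs) ≡ occ x xs
  occ-suc-map-suc x []       = refl
  occ-suc-map-suc x (y ∷ xs) with x ≟ y
  ... | yes _ = cong suc (occ-suc-map-suc x xs)
  ... | no  _ = occ-suc-map-suc x xs

  occ-zero-map-suc : ∀ (xs : List (Fin n)) → occ zero (map suc xs) ≡ 0
  occ-zero-map-suc []       = refl
  occ-zero-map-suc (_ ∷ xs) = occ-zero-map-suc xs

  -- The windows of length r = |L| of a word of period r are rotations of L.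
  occ-window-repeat : ∀ (x : Fin n) L k j → j ≤ k * length L →
                      occ x (take (length L) (drop j (repeat (2 + k) L))) ≡ occ x L
  occ-window-repeat x L k j j≤ with j ≤? length L
  ... | yes j≤r = trans (cong (occ x) (take-drop-rotate j L (repeat k L) j≤r)) (occ-rotate x j L)
  occ-window-repeat x L zero    j j≤ | no j≰r = contradiction (≤-trans j≤ z≤n) j≰r
  occ-window-repeat x L (suc k) j j≤ | no j≰r = begin
    occ x (take r (drop j (L ++ repeat (2 + k) L)))   ≡⟨ cong (λ w → occ x (take r w)) (drop-++-≥ j L _ r≤j) ⟩
    occ x (take r (drop (j ∸ r) (repeat (2 + k) L)))  ≡⟨ occ-window-repeat x L k (j ∸ r) j∸r≤ ⟩
    occ x L                                           ∎
    where
    open ≡-Reasoning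
    r = length L
    r≤j : r ≤ j
    r≤j = ≤-trans (n≤1+n r) (≰⇒> j≰r)
    j∸r≤ : j ∸ r ≤ k * r
    j∸r≤ = subst (j ∸ r ≤_) (m+n∸m≡n r (k * r)) (∸-monoˡ-≤ r j≤)

elements : ∀ {n} → Subset n → List (Fin n)
elements []            = []
elements (inside  ∷ p) = zero ∷ map suc (elements p)
elements (outside ∷ p) = map suc (elements p)

length-elements : ∀ {n} (p : Subset n) → length (elements p) ≡ ∣ p ∣
length-elements []            = refl
length-elements (inside  ∷ p) = cong suc (trans (length-map suc (elements p)) (length-elements p))
length-elements (outside ∷ p) = trans (length-map suc (elements p)) (length-elements p)

elements-∈ : ∀ {n} (p : Subset n) → All (_∈ p) (elements p)
elements-∈ []            = []
elements-∈ (inside  ∷ p) = here ∷ All.map⁺ (All.map there (elements-∈ p))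
elements-∈ (outside ∷ p) = All.map⁺ (All.map there (elements-∈ p))

occ-elements : ∀ {n} (p : Subset n) x → x ∈ p → occ x (elements p) ≡ 1
occ-elements (inside  ∷ p) zero    here        = cong suc (occ-zero-map-suc (elements p))
occ-elements (inside  ∷ p) (suc x) (there x∈p) = trans (occ-suc-map-suc x (elements p)) (occ-elements p x x∈p)
occ-elements (outside ∷ p) (suc x) (there x∈p) = trans (occ-suc-map-suc x (elements p)) (occ-elements p x x∈p)

elements⁺ : ∀ {n} {p q : Subset n} → p ⊆ q → elements p Sublist.⊆ elements q
elements⁺ {p = []}          {q = []}          _   = []
elements⁺ {p = inside  ∷ p} {q = inside  ∷ q} p⊆q = refl ∷ map⁺ suc (elements⁺ (drop-∷-⊆ p⊆q))
elements⁺ {p = inside  ∷ p} {q = outside ∷ q} p⊆q with () ← p⊆q here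
elements⁺ {p = outside ∷ p} {q = inside  ∷ q} p⊆q = zero ∷ʳ map⁺ suc (elements⁺ (drop-∷-⊆ p⊆q))
elements⁺ {p = outside ∷ p} {q = outside ∷ q} p⊆q = map⁺ suc (elements⁺ (drop-∷-⊆ p⊆q))

nonempty : ∀ {n} {p : Subset n} → 1 ≤ ∣ p ∣ → Nonempty p
nonempty {n} {p} 1≤∣p∣ with nonempty? p
... | yes p≢∅ = p≢∅
... | no  p≢∅ with () ← subst (1 ≤_) (trans (cong ∣_∣ (Empty-unique p≢∅)) (∣⊥∣≡0 n)) 1≤∣p∣

module _ {n : ℕ} (Δ : SimplicialComplex n) where

  facet-if-unextendable : ∀ {σ} → face Δ σ → (∀ x → x ∉ σ → ¬ face Δ (σ ∪ ⁅ x ⁆)) → IsFacet Δ σ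
  facet-if-unextendable {σ} fσ unextendable = fσ , λ τ fτ σ⊆τ → ⊆-antisym (τ⊆σ fτ σ⊆τ) σ⊆τ
    where
    τ⊆σ : ∀ {τ} → face Δ τ → σ ⊆ τ → τ ⊆ σ
    τ⊆σ {τ} fτ σ⊆τ {x} x∈τ with x ∈? σ
    ... | yes x∈σ = x∈σ
    ... | no  x∉σ = contradiction (downClose Δ σ∪x⊆τ fτ) (unextendable x x∉σ)
      where
      σ∪x⊆τ : σ ∪ ⁅ x ⁆ ⊆ τ
      σ∪x⊆τ y∈ with x∈p∪q⁻ σ ⁅ x ⁆ y∈
      ... | inj₁ y∈σ = σ⊆τ y∈σ
      ... | inj₂ y∈x = subst (_∈ τ) (sym (x∈⁅y⁆⇒x≡y x y∈x)) x∈τ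

  facet-above : ∀ {σ} → face Δ σ → ∃ λ τ → σ ⊆ τ × IsFacet Δ τ
  facet-above {σ} = go σ (⊃-wellFounded σ)
    where
    go : ∀ σ → Acc _⊃_ σ → face Δ σ → ∃ λ τ → σ ⊆ τ × IsFacet Δ τ
    go σ (acc rec) fσ with any? (λ x → ¬? (x ∈? σ) ×-dec face? Δ (σ ∪ ⁅ x ⁆))
    ... | yes (x , x∉σ , fσ∪x) with go (σ ∪ ⁅ x ⁆) (rec σ⊂σ∪x) fσ∪x
      where
      σ⊂σ∪x : σ ⊂ σ ∪ ⁅ x ⁆
      σ⊂σ∪x = p⊆p∪q ⁅ x ⁆ , x , x∈p∪q⁺ (inj₂ (x∈⁅x⁆ x)) , x∉σ
    ...   | τ , σ∪x⊆τ , τ-facet = τ , (λ y∈σ → σ∪x⊆τ (p⊆p∪q ⁅ x ⁆ y∈σ)) , τ-facet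
    go σ _ fσ | no unextendable =
      σ , (λ x∈σ → x∈σ) , facet-if-unextendable fσ (λ x x∉σ fσ∪x → unextendable (x , x∉σ , fσ∪x))

Segments : ∀ {n} → ℕ → Subset n → List (Fin n) → Set
Segments {n} d σ u = ∀ i → i ≤ d → ∀ (x : Fin n) → x ∈ σ → occ x (take ∣ σ ∣ (drop (i * (∣ σ ∣ ∸ 1)) u)) ≡ 1

module _ {n : ℕ} {σ : Subset n} where

  segments-drop : ∀ {d} {u : List (Fin n)} → Segments (suc d) σ u → Segments d σ (drop (∣ σ ∣ ∸ 1) u)
  segments-drop {u = u} seg i i≤d x x∈σ =
    trans (cong (λ w → occ x (take ∣ σ ∣ w)) (drop-drop (∣ σ ∣ ∸ 1) (i * (∣ σ ∣ ∸ 1)) u)) (seg (suc i) (s≤s i≤d) x x∈σ)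

  -- If the first segment is not inside the first block B, then u meets B in at
  -- most r - 1 letters, so dropping the first r - 1 letters of u leaves a
  -- subword of the remaining blocks.
  segment-within-block : Nonempty σ → ∀ (bs : List (List (Fin n))) d u →
                         length bs ≤ d → u Sublist.⊆ concat bs → Segments d σ u →
                         Any (λ B → ∀ {x} → x ∈ σ → x List.∈ B) bs
  segment-within-block (x₀ , x₀∈σ) [] d .[] _ [] seg =
    contradiction (trans (sym (seg 0 z≤n x₀ x₀∈σ)) (cong (occ x₀) (take-[] ∣ σ ∣))) λ ()
  segment-within-block σ≢∅ (B ∷ bs) (suc d) u (s≤s len≤d) u⊆ seg
    with ⊆-++-split B u⊆
  ... | u₁ , u₂ , refl , u₁⊆B , u₂⊆bs with ∣ σ ∣ ≤? length u₁
  ...   | yes r≤ = here λ {x} x∈σ →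
    Any-resp-⊆ (⊆-trans (take-⊆ ∣ σ ∣ u₁) u₁⊆B)
      (occ≡suc⇒∈ x _ (trans (cong (occ x) (sym (take-++ˡ ∣ σ ∣ u₁ u₂ r≤))) (seg 0 z≤n x x∈σ)))
  ...   | no  r≰ = there (segment-within-block σ≢∅ bs d _ len≤d rest⊆bs (segments-drop seg))
    where
    rest⊆bs : drop (∣ σ ∣ ∸ 1) (u₁ ++ u₂) Sublist.⊆ concat bs
    rest⊆bs = subst (Sublist._⊆ concat bs) (sym (drop-++-≥ (∣ σ ∣ ∸ 1) u₁ u₂ (∸-monoˡ-≤ 1 (≰⇒> r≰))))
                (⊆-trans (drop-⊆ (∣ σ ∣ ∸ 1 ∸ length u₁) u₂) u₂⊆bs)

segment-end≤length : ∀ {i d r} → 1 ≤ r → i ≤ d → i * (r ∸ 1) + r ≤ suc d * (r ∸ 1) + 1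
segment-end≤length {i} {d} {suc r′} _ i≤d = begin
  i * r′ + suc r′   ≡⟨ +-suc (i * r′) r′ ⟩
  suc (i * r′ + r′) ≡⟨ cong suc (+-comm (i * r′) r′) ⟩
  suc (suc i * r′)  ≡⟨ +-comm 1 (suc i * r′) ⟩
  suc i * r′ + 1    ≤⟨ +-monoˡ-≤ 1 (*-monoˡ-≤ r′ (s≤s i≤d)) ⟩
  suc d * r′ + 1    ∎
  where open ≤-Reasoning

length≤repeat-length : ∀ {d r} → 1 ≤ r → suc d * (r ∸ 1) + 1 ≤ (2 + d) * r
length≤repeat-length {d} {r} 1≤r =
  subst (_≤ (2 + d) * r) (+-comm 1 (suc d * (r ∸ 1))) (+-mono-≤ 1≤r (*-monoʳ-≤ (suc d) (m∸n≤m r 1)))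

colorful-word : ∀ {n} → ℕ → Subset n → List (Fin n)
colorful-word d σ = take (suc d * (∣ σ ∣ ∸ 1) + 1) (repeat (2 + d) (elements σ))

colorful-word-isColorful : ∀ {n} d (σ : Subset n) → 1 ≤ ∣ σ ∣ → IsColorful d σ (colorful-word d σ)
colorful-word-isColorful d σ 1≤r = length-word , All.take⁺ N (All-repeat (2 + d) (elements-∈ σ)) , segments
  where
  r = ∣ σ ∣
  N = suc d * (r ∸ 1) + 1
  L = elements σ
  P = repeat (2 + d) L
  length-P : length P ≡ (2 + d) * r
  length-P = trans (length-repeat (2 + d) L) (cong ((2 + d) *_) (length-elements σ))
  length-word : length (take N P) ≡ N
  length-word = trans (length-take N P) (m≤n⇒m⊓n≡m (subst (N ≤_) (sym length-P) (length≤repeat-length {d = d} 1≤r)))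
  segments : Segments d σ (take N P)
  segments i i≤d x x∈σ = begin
    occ x (take r (drop j (take N P)))     ≡⟨ cong (occ x) (take-drop-take j r N P (segment-end≤length {d = d} 1≤r i≤d)) ⟩
    occ x (take r (drop j P))              ≡⟨ cong (λ k → occ x (take k (drop j P))) (sym (length-elements σ)) ⟩
    occ x (take (length L) (drop j P))     ≡⟨ occ-window-repeat x L d j j≤ ⟩
    occ x L                                ≡⟨ occ-elements σ x x∈σ ⟩
    1                                      ∎
    where
    open ≡-Reasoning
    j = i * (r ∸ 1)
    j≤ : j ≤ d * length L
    j≤ = subst (λ k → j ≤ d * k) (sym (length-elements σ)) (*-mono-≤ i≤d (m∸n≤m r 1))

proposition5p2 : (n : ℕ) (Δ : SimplicialComplex n) (m : ℕ) →
    HasFacetCount Δ m → ColorfullyRepresentable (m + 1) Δ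
proposition5p2 n Δ m (fs , _ , length-fs , facets) = W , λ σ 2≤∣σ∣ → represent σ (<⇒≤ 2≤∣σ∣) , reflect σ (<⇒≤ 2≤∣σ∣)
  where
  d = m + 1
  block : Subset n → List (Fin n)
  block F = repeat (2 + d) (elements F)
  W = concat (map block fs)
  ColorfulSubword : Subset n → Set
  ColorfulSubword σ = Σ (List (Fin n)) λ u → u Sublist.⊆ W × IsColorful d σ u

  represent : ∀ σ → 1 ≤ ∣ σ ∣ → face Δ σ → ColorfulSubword σ
  represent σ 1≤∣σ∣ fσ =
    let τ , σ⊆τ , τ-facet = facet-above Δ fσ
        block-τ⊆W = ∈⇒⊆-concat (∈-map⁺ block (proj₂ (facets τ) τ-facet))
    in colorful-word d σ ,
       ⊆-trans (take-⊆ _ _) (⊆-trans (repeat⁺ (2 + d) (elements⁺ σ⊆τ)) block-τ⊆W) ,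
       colorful-word-isColorful d σ 1≤∣σ∣

  reflect : ∀ σ → 1 ≤ ∣ σ ∣ → ColorfulSubword σ → face Δ σ
  reflect σ 1≤∣σ∣ (u , u⊆W , _ , _ , segments) =
    let blocks≤d = subst (_≤ d) (sym (trans (length-map block fs) length-fs)) (m≤m+n m 1)
        F , F∈fs , σ⊆block-F = List.find (Any.map⁻
          (segment-within-block (nonempty 1≤∣σ∣) (map block fs) d u blocks≤d u⊆W segments))
        block-F⊆F = All-repeat (2 + d) (elements-∈ F)
    in downClose Δ (λ x∈σ → All.lookup block-F⊆F (σ⊆block-F x∈σ)) (proj₁ (proj₁ (facets F) F∈fs))
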